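{- Let $\Sigma=(J_n)_{n\ge0}$ be a predicate structure, $f$ an assignment in $\Sigma$, $n,m\ge1$, $\mathbf x=(x_1,\dots,x_n)$ a tuple of distinct individual variables, $D$ an $m$-ary predicate variable, and $H=H(\mathbf x,D)$ a second-order formula. Put \[\mathcal A^H=\{(\xi,\delta)\in J_0^n\times J_m:\ \Sigma\models_{f\langle \mathbf x/\xi,\,D/\delta\rangle}H\},\qquad \mathcal A^H_\xi=\{\delta\in J_m:(\xi,\delta)\in\mathcal A^H\}\ \ (\xi\in J_0^n).\] (1) If $\Sigma\models_f\forall\mathbf x\exists D\,H(\mathbf x,D)$, then for every $\xi\in J_0^n$ the uniquely determined set $\mathcal A^H_\xi\subseteq J_m$ is non-empty. (2) Let $\mathbf y$ be an $m$-tuple of distinct individual variables not occurring in $H$ and $S$ an $(n+m)$-ary predicate variable not occurring in $H$. If $\varphi$ is a choice function on the family $(\mathcal A^H_\xi)_{\xi\in J_0^n}$, i.e. $\varphi(\mathcal A^H_\xi)\in\mathcal A^H_\xi$ for all $\xi\in J_0^n$, and if the $(n+m)$-ary predicate $\sigma_\varphi$ with $\widetilde{\sigma_\varphi}=\{(\xi.\eta):\xi\in J_0^n,\ \eta\in\widetilde{\varphi(\mathcal A^H_\xi)}\}$ belongs to $J_{n+m}$, then \[\Sigma\models_{f\langle S/\sigma_\varphi\rangle}\forall\mathbf x\exists D\big(\forall\mathbf y(D\mathbf y\leftrightarrow S\mathbf x\mathbf y)\land H(\mathbf x,D)\big).\]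
   Context: For a nonempty set $I$, ${\rm pred}_n(I)$ is the set of maps $\alpha:I^n\to\{true,false\}$, with extension $\widetilde\alpha=\{\xi\in I^n:\alpha(\xi)=true\}$; membership $\eta\in\alpha$ means $\eta\in\widetilde\alpha$. A predicate structure with individual domain $I$ is $\Sigma=(J_n)_{n\ge0}$ with $J_0=I$ and $\emptyset\neq J_n\subseteq{\rm pred}_n(I)$ for $n\ge1$. An assignment $f$ sends individual variables into $J_0$ and $n$-ary predicate variables into $J_n$; $f\langle \mathbf x/\xi, D/\delta\rangle$ is the assignment modified to send $x_i$ to $\xi_i$ and $D$ to $\delta$. Second-order formulas are evaluated with $n$-ary predicate quantifiers ranging over $J_n$ only (Henkin semantics); $\Sigma\models_f F$ means $F$ is true in $\Sigma$ under $f$. $(\xi.\eta)$ denotes concatenation of tuples, and $S\mathbf x\mathbf y$ is the atomic formula $S$ applied to the concatenation of $\mathbf x$ and $\mathbf y$. -}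

module Defs where

open import Data.Nat using (ℕ; zero; suc; _+_; NonZero; _≟_)
open import Data.Bool using (Bool; true; false)
open import Data.Vec using (Vec; []; _∷_; map; _++_)
open import Data.Vec.Relation.Unary.Any using (Any)
open import Data.Product using (Σ; _×_; _,_; proj₁)
open import Data.Sum using (_⊎_)
open import Data.Empty using (⊥)
open import Relation.Nullary using (¬_; yes; no)
open import Relation.Binary.PropositionalEquality using (_≡_; refl)

Pred : Set → ℕ → Set
Pred I n = Vec I n → Bool

_∈ₚ_ : {I : Set} {n : ℕ} → Vec I n → Pred I n → Set
η ∈ₚ α = α η ≡ true

-- Predicate structures  Σ = (J_n)_{n ≥ 0},  J_0 = I (nonempty),
-- ∅ ≠ J_n ⊆ pred_n(I) for n ≥ 1.  (J is only consulted for n ≥ 1.)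

record Structure : Set₁ where
  field
    I        : Set
    i₀       : I
    J        : (n : ℕ) → .(NonZero n) → Pred I n → Set
    J-ne     : (n : ℕ) → .(nz : NonZero n) → Σ (Pred I n) (J n nz)

open Structure public

Elt : (𝔖 : Structure) (n : ℕ) → .(NonZero n) → Set
Elt 𝔖 n nz = Σ (Pred (I 𝔖) n) (J 𝔖 n nz)

IVar : Set
IVar = ℕ

PName : Set
PName = ℕ

data Formula : Set where
  atom  : (n : ℕ) → .(NonZero n) → PName → Vec IVar n → Formula
  _≐_   : IVar → IVar → Formula
  ⊥ᶠ    : Formula
  ¬ᶠ_   : Formula → Formula
  _∧ᶠ_  : Formula → Formula → Formula
  _∨ᶠ_  : Formula → Formula → Formula
  _⇒ᶠ_  : Formula → Formula → Formula
  _⇔ᶠ_  : Formula → Formula → Formula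
  ∀ᵢ    : IVar → Formula → Formula
  ∃ᵢ    : IVar → Formula → Formula
  ∀ₚ    : (n : ℕ) → .(NonZero n) → PName → Formula → Formula
  ∃ₚ    : (n : ℕ) → .(NonZero n) → PName → Formula → Formula

∀ᵢ* : {n : ℕ} → Vec IVar n → Formula → Formula
∀ᵢ* []       F = F
∀ᵢ* (x ∷ xs) F = ∀ᵢ x (∀ᵢ* xs F)

OccI : IVar → Formula → Set
OccI v (atom n _ P xs) = Any (v ≡_) xs
OccI v (x ≐ y)         = (v ≡ x) ⊎ (v ≡ y)
OccI v ⊥ᶠ              = ⊥
OccI v (¬ᶠ F)          = OccI v F
OccI v (F ∧ᶠ G)        = OccI v F ⊎ OccI v G
OccI v (F ∨ᶠ G)        = OccI v F ⊎ OccI v G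
OccI v (F ⇒ᶠ G)        = OccI v F ⊎ OccI v G
OccI v (F ⇔ᶠ G)        = OccI v F ⊎ OccI v G
OccI v (∀ᵢ x F)        = (v ≡ x) ⊎ OccI v F
OccI v (∃ᵢ x F)        = (v ≡ x) ⊎ OccI v F
OccI v (∀ₚ _ _ _ F)    = OccI v F
OccI v (∃ₚ _ _ _ F)    = OccI v F

OccP : ℕ → PName → Formula → Set
OccP k Q (atom n _ P xs) = (k ≡ n) × (Q ≡ P)
OccP k Q (x ≐ y)         = ⊥
OccP k Q ⊥ᶠ              = ⊥
OccP k Q (¬ᶠ F)          = OccP k Q F
OccP k Q (F ∧ᶠ G)        = OccP k Q F ⊎ OccP k Q G
OccP k Q (F ∨ᶠ G)        = OccP k Q F ⊎ OccP k Q G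
OccP k Q (F ⇒ᶠ G)        = OccP k Q F ⊎ OccP k Q G
OccP k Q (F ⇔ᶠ G)        = OccP k Q F ⊎ OccP k Q G
OccP k Q (∀ᵢ x F)        = OccP k Q F
OccP k Q (∃ᵢ x F)        = OccP k Q F
OccP k Q (∀ₚ n _ P F)    = ((k ≡ n) × (Q ≡ P)) ⊎ OccP k Q F
OccP k Q (∃ₚ n _ P F)    = ((k ≡ n) × (Q ≡ P)) ⊎ OccP k Q F

record Assignment (𝔖 : Structure) : Set where
  field
    ind  : IVar → I 𝔖
    pred : (n : ℕ) → .(nz : NonZero n) → PName → Elt 𝔖 n nz

open Assignment public

updI : {𝔖 : Structure} → Assignment 𝔖 → IVar → I 𝔖 → Assignment 𝔖
ind  (updI f x a) v with v ≟ x
... | yes _ = a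
... | no  _ = ind f v
pred (updI f x a) = pred f

updV : {𝔖 : Structure} {n : ℕ} → Assignment 𝔖 → Vec IVar n → Vec (I 𝔖) n → Assignment 𝔖
updV f []       []       = f
updV f (x ∷ xs) (a ∷ as) = updI (updV f xs as) x a

updP : {𝔖 : Structure} → Assignment 𝔖 → (n : ℕ) → .(nz : NonZero n) → PName
     → Elt 𝔖 n nz → Assignment 𝔖
ind  (updP f n nz D δ) = ind f
pred (updP f n nz D δ) k nzk Q with k ≟ n | Q ≟ D
... | yes refl | yes refl = δ
... | _        | _        = pred f k nzk Q

-- Henkin semantics:  Sat 𝔖 f F  is  "𝔖 ⊨_f F"

Sat : (𝔖 : Structure) → Assignment 𝔖 → Formula → Set
Sat 𝔖 f (atom n nz P xs) = map (ind f) xs ∈ₚ proj₁ (pred f n nz P)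
Sat 𝔖 f (x ≐ y)          = ind f x ≡ ind f y
Sat 𝔖 f ⊥ᶠ               = ⊥
Sat 𝔖 f (¬ᶠ F)           = ¬ Sat 𝔖 f F
Sat 𝔖 f (F ∧ᶠ G)         = Sat 𝔖 f F × Sat 𝔖 f G
Sat 𝔖 f (F ∨ᶠ G)         = Sat 𝔖 f F ⊎ Sat 𝔖 f G
Sat 𝔖 f (F ⇒ᶠ G)         = Sat 𝔖 f F → Sat 𝔖 f G
Sat 𝔖 f (F ⇔ᶠ G)         = (Sat 𝔖 f F → Sat 𝔖 f G) × (Sat 𝔖 f G → Sat 𝔖 f F)
Sat 𝔖 f (∀ᵢ x F)         = (a : I 𝔖) → Sat 𝔖 (updI f x a) F
Sat 𝔖 f (∃ᵢ x F)         = Σ (I 𝔖) λ a → Sat 𝔖 (updI f x a) F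
Sat 𝔖 f (∀ₚ n nz D F)    = (δ : Elt 𝔖 n nz) → Sat 𝔖 (updP f n nz D δ) F
Sat 𝔖 f (∃ₚ n nz D F)    = Σ (Elt 𝔖 n nz) λ δ → Sat 𝔖 (updP f n nz D δ) F

nz+ : (n m : ℕ) → .(NonZero n) → NonZero (n + m)
nz+ (suc n) m _ = _

𝒜 : (𝔖 : Structure) (f : Assignment 𝔖) {n : ℕ} (m : ℕ) .(nzm : NonZero m)
    (x : Vec IVar n) (D : PName) (H : Formula) → Vec (I 𝔖) n → Elt 𝔖 m nzm → Set
𝒜 𝔖 f m nzm x D H ξ δ = Sat 𝔖 (updP (updV f x ξ) m nzm D δ) H

-- Part (1) is ∀-elimination over a tuple of distinct variables. For part (2) one takes D := φ(𝒜^H_ξ)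
-- at ξ: H then holds because S does not occur in H (coincidence lemma), and ∀y (D y ↔ S x y) holds
-- because σ is, by hypothesis, the graph of ξ ↦ φ(𝒜^H_ξ).
module Submission where

open import Defs
open import Data.Nat using (ℕ; NonZero; _+_; _≟_; >-nonZero⁻¹)
open import Data.Nat.Properties using (m<n+m; <⇒≢)
open import Data.Vec using (Vec; []; _∷_; map; _++_)
open import Data.Vec.Properties using (map-++)
open import Data.Vec.Relation.Unary.Any using (Any; here; there)
import Data.Vec.Relation.Unary.All as All
open import Data.Vec.Relation.Unary.AllPairs using (_∷_)
open import Data.Vec.Relation.Unary.Unique.Propositional using (Unique)
open import Data.Vec.Membership.Propositional using (_∈_; _∉_)
open import Data.Unit using (⊤)
open import Data.Product using (Σ; _×_; _,_; proj₁)
open import Data.Sum using (inj₁; inj₂)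
open import Data.Empty using (⊥-elim)
open import Function using (_∘_)
open import Relation.Nullary using (¬_; Dec; yes; no)
open import Relation.Binary.PropositionalEquality
  using (_≡_; _≢_; refl; sym; trans; cong₂; subst₂; ≢-sym; module ≡-Reasoning)

head∉tail : ∀ {n} {x : IVar} {xs : Vec IVar n} → Unique (x ∷ xs) → x ∉ xs
head∉tail (x≢xs ∷ _) x∈xs = All.lookup x≢xs x∈xs refl

n+m≢m : ∀ n m → NonZero n → n + m ≢ m
n+m≢m n m nzn = ≢-sym (<⇒≢ (m<n+m m (>-nonZero⁻¹ n {{nzn}})))

map-cong-∈ : ∀ {A B : Set} {n} {f g : A → B} (xs : Vec A n) →
             (∀ v → v ∈ xs → f v ≡ g v) → map f xs ≡ map g xs
map-cong-∈ []       f≗g = refl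
map-cong-∈ (x ∷ xs) f≗g = cong₂ _∷_ (f≗g x (here refl)) (map-cong-∈ xs (λ v v∈xs → f≗g v (there v∈xs)))

module _ {𝔖 : Structure} where

  Agree : (ℕ → PName → Set) → Assignment 𝔖 → Assignment 𝔖 → Set
  Agree P f g = (∀ v → ind f v ≡ ind g v)
              × (∀ k → .(nz : NonZero k) → ∀ Q → P k Q → pred f k nz Q ≡ pred g k nz Q)

  _≈_ : Assignment 𝔖 → Assignment 𝔖 → Set
  f ≈ g = Agree (λ _ _ → ⊤) f g

  Agree-sym : ∀ {P f g} → Agree P f g → Agree P g f
  Agree-sym (i , p) = (λ v → sym (i v)) , (λ k .nz Q o → sym (p k nz Q o))

  Agree-mono : ∀ {P P′ f g} → (∀ {k Q} → P k Q → P′ k Q) → Agree P′ f g → Agree P f g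
  Agree-mono P⊆P′ (i , p) = i , (λ k .nz Q o → p k nz Q (P⊆P′ o))

  ≈-trans : ∀ {f g h} → f ≈ g → g ≈ h → f ≈ h
  ≈-trans (i , p) (j , q) = (λ v → trans (i v) (j v)) , (λ k .nz Q o → trans (p k nz Q o) (q k nz Q o))

  ≈⇒Agree : ∀ {P f g} → f ≈ g → Agree P f g
  ≈⇒Agree = Agree-mono _

  updI-cong : ∀ {P f g} x a → Agree P f g → Agree P (updI f x a) (updI g x a)
  updI-cong {P} {f} {g} x a (i , p) = i′ , p
    where
    i′ : ∀ v → ind (updI f x a) v ≡ ind (updI g x a) v
    i′ v with v ≟ x
    ... | yes _ = refl
    ... | no  _ = i v

  updV-cong : ∀ {P f g n} (xs : Vec IVar n) as → Agree P f g → Agree P (updV f xs as) (updV g xs as)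
  updV-cong []       []       e = e
  updV-cong (x ∷ xs) (a ∷ as) e = updI-cong x a (updV-cong xs as e)

  updP-cong : ∀ {P f g} n .(nz : NonZero n) D δ → Agree P f g → Agree P (updP f n nz D δ) (updP g n nz D δ)
  updP-cong {P} {f} {g} n nz D δ (i , p) = i , p′
    where
    p′ : ∀ k → .(nzk : NonZero k) → ∀ Q → P k Q → pred (updP f n nz D δ) k nzk Q ≡ pred (updP g n nz D δ) k nzk Q
    p′ k nzk Q o with k ≟ n | Q ≟ D
    ... | yes refl | yes refl = refl
    ... | yes refl | no  _    = p k nzk Q o
    ... | no  _    | _        = p k nzk Q o

  Sat-resp-Agree : ∀ F {f g} → Agree (λ k Q → OccP k Q F) f g → Sat 𝔖 f F → Sat 𝔖 g F
  Sat-resp-Agree (atom n nz P xs) (i , p) s =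
    subst₂ (λ ξ α → proj₁ α ξ ≡ _) (map-cong-∈ xs (λ v _ → i v)) (p n nz P (refl , refl)) s
  Sat-resp-Agree (x ≐ y)   (i , _) s = trans (sym (i x)) (trans s (i y))
  Sat-resp-Agree ⊥ᶠ        _ ()
  Sat-resp-Agree (¬ᶠ F)    e ¬s t = ¬s (Sat-resp-Agree F (Agree-sym e) t)
  Sat-resp-Agree (F ∧ᶠ G)  e (s , t) = Sat-resp-Agree F (Agree-mono inj₁ e) s , Sat-resp-Agree G (Agree-mono inj₂ e) t
  Sat-resp-Agree (F ∨ᶠ G)  e (inj₁ s) = inj₁ (Sat-resp-Agree F (Agree-mono inj₁ e) s)
  Sat-resp-Agree (F ∨ᶠ G)  e (inj₂ t) = inj₂ (Sat-resp-Agree G (Agree-mono inj₂ e) t)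
  Sat-resp-Agree (F ⇒ᶠ G)  e s⇒t u =
    Sat-resp-Agree G (Agree-mono inj₂ e) (s⇒t (Sat-resp-Agree F (Agree-sym (Agree-mono inj₁ e)) u))
  Sat-resp-Agree (F ⇔ᶠ G)  e (s⇒t , t⇒s) =
    (λ u → Sat-resp-Agree G (Agree-mono inj₂ e) (s⇒t (Sat-resp-Agree F (Agree-sym (Agree-mono inj₁ e)) u))) ,
    (λ u → Sat-resp-Agree F (Agree-mono inj₁ e) (t⇒s (Sat-resp-Agree G (Agree-sym (Agree-mono inj₂ e)) u)))
  Sat-resp-Agree (∀ᵢ x F)  e s a = Sat-resp-Agree F (updI-cong x a e) (s a)
  Sat-resp-Agree (∃ᵢ x F)  e (a , s) = a , Sat-resp-Agree F (updI-cong x a e) s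
  Sat-resp-Agree (∀ₚ n nz D F) e s δ = Sat-resp-Agree F (updP-cong n nz D δ (Agree-mono inj₂ e)) (s δ)
  Sat-resp-Agree (∃ₚ n nz D F) e (δ , s) = δ , Sat-resp-Agree F (updP-cong n nz D δ (Agree-mono inj₂ e)) s

  updI-self : ∀ (f : Assignment 𝔖) x a → ind (updI f x a) x ≡ a
  updI-self f x a with x ≟ x
  ... | yes _   = refl
  ... | no  x≢x = ⊥-elim (x≢x refl)

  updI-other : ∀ (f : Assignment 𝔖) x a {v} → v ≢ x → ind (updI f x a) v ≡ ind f v
  updI-other f x a {v} v≢x with v ≟ x
  ... | yes v≡x = ⊥-elim (v≢x v≡x)
  ... | no  _   = refl

  updI-comm : ∀ (f : Assignment 𝔖) {x y} a b → x ≢ y → updI (updI f x a) y b ≈ updI (updI f y b) x a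
  updI-comm f {x} {y} a b x≢y = i , λ _ _ _ _ → refl
    where
    i : ∀ v → ind (updI (updI f x a) y b) v ≡ ind (updI (updI f y b) x a) v
    i v = by-cases (v ≟ x) (v ≟ y)
      where
      by-cases : Dec (v ≡ x) → Dec (v ≡ y) → ind (updI (updI f x a) y b) v ≡ ind (updI (updI f y b) x a) v
      by-cases (yes refl) (yes refl) = ⊥-elim (x≢y refl)
      by-cases (yes refl) (no v≢y)   =
        trans (updI-other _ y b v≢y) (trans (updI-self f v a) (sym (updI-self _ v a)))
      by-cases (no v≢x)   (yes refl) =
        trans (updI-self _ v b) (sym (trans (updI-other _ x a v≢x) (updI-self f v b)))
      by-cases (no v≢x)   (no v≢y)   =
        trans (updI-other _ y b v≢y) (trans (updI-other f x a v≢x)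
          (sym (trans (updI-other _ x a v≢x) (updI-other f y b v≢y))))

  updV-other : ∀ {n} (f : Assignment 𝔖) (xs : Vec IVar n) as {v} → v ∉ xs → ind (updV f xs as) v ≡ ind f v
  updV-other f []       []       v∉xs = refl
  updV-other f (x ∷ xs) (a ∷ as) v∉xs =
    trans (updI-other (updV f xs as) x a (v∉xs ∘ here)) (updV-other f xs as (v∉xs ∘ there))

  updV-self : ∀ {n} (f : Assignment 𝔖) (xs : Vec IVar n) as → Unique xs → map (ind (updV f xs as)) xs ≡ as
  updV-self f []       []       _ = refl
  updV-self f (x ∷ xs) (a ∷ as) u@(_ ∷ u′) = cong₂ _∷_ (updI-self (updV f xs as) x a) (begin
    map (ind (updI (updV f xs as) x a)) xs ≡⟨ map-cong-∈ xs (λ v v∈xs → updI-other (updV f xs as) x a (λ { refl → head∉tail u v∈xs })) ⟩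
    map (ind (updV f xs as)) xs            ≡⟨ updV-self f xs as u′ ⟩
    as                                      ∎)
    where open ≡-Reasoning

  updV-self-++ : ∀ {n m} (f : Assignment 𝔖) (xs : Vec IVar n) (ys : Vec IVar m) as bs →
                 Unique ys → (∀ v → v ∈ ys → v ∉ xs) → map (ind f) xs ≡ as →
                 map (ind (updV f ys bs)) (xs ++ ys) ≡ as ++ bs
  updV-self-++ f xs ys as bs uys ys#xs f[xs]≡as = begin
    map (ind (updV f ys bs)) (xs ++ ys)                       ≡⟨ map-++ _ xs ys ⟩
    map (ind (updV f ys bs)) xs ++ map (ind (updV f ys bs)) ys ≡⟨ cong₂ _++_ f[xs]≡as′ (updV-self f ys bs uys) ⟩
    as ++ bs                                                   ∎
    where
    open ≡-Reasoning
    f[xs]≡as′ : map (ind (updV f ys bs)) xs ≡ as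
    f[xs]≡as′ = trans (map-cong-∈ xs (λ v v∈xs → updV-other f ys bs (λ v∈ys → ys#xs v v∈ys v∈xs))) f[xs]≡as

  updV-pred : ∀ {n} (f : Assignment 𝔖) (xs : Vec IVar n) as k .(nz : NonZero k) Q →
              pred (updV f xs as) k nz Q ≡ pred f k nz Q
  updV-pred f []       []       k nz Q = refl
  updV-pred f (x ∷ xs) (a ∷ as) k nz Q = updV-pred f xs as k nz Q

  updV-updI : ∀ {n} (f : Assignment 𝔖) x a (xs : Vec IVar n) as → x ∉ xs →
              updV (updI f x a) xs as ≈ updI (updV f xs as) x a
  updV-updI f x a []       []       _    = (λ _ → refl) , (λ _ _ _ _ → refl)
  updV-updI f x a (y ∷ ys) (b ∷ bs) x∉xs =
    ≈-trans (updI-cong y b (updV-updI f x a ys bs (x∉xs ∘ there))) (updI-comm (updV f ys bs) a b (x∉xs ∘ here))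

  updP-self : ∀ (f : Assignment 𝔖) n .(nz : NonZero n) D δ → pred (updP f n nz D δ) n nz D ≡ δ
  updP-self f n nz D δ with n ≟ n | D ≟ D
  ... | yes refl | yes refl = refl
  ... | yes refl | no  D≢D  = ⊥-elim (D≢D refl)
  ... | no  n≢n  | _        = ⊥-elim (n≢n refl)

  updP-other : ∀ (f : Assignment 𝔖) n .(nz : NonZero n) D δ k .(nzk : NonZero k) Q →
               ¬ (k ≡ n × Q ≡ D) → pred (updP f n nz D δ) k nzk Q ≡ pred f k nzk Q
  updP-other f n nz D δ k nzk Q ne with k ≟ n | Q ≟ D
  ... | yes refl | yes refl = ⊥-elim (ne (refl , refl))
  ... | yes refl | no  _    = refl
  ... | no  _    | _        = refl

  Sat-∀ᵢ*⁻ : ∀ {n} (f : Assignment 𝔖) (xs : Vec IVar n) F → Unique xs →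
             Sat 𝔖 f (∀ᵢ* xs F) → ∀ as → Sat 𝔖 (updV f xs as) F
  Sat-∀ᵢ*⁻ f []       F _ s [] = s
  Sat-∀ᵢ*⁻ f (x ∷ xs) F u@(_ ∷ u′) s (a ∷ as) =
    Sat-resp-Agree F (≈⇒Agree (updV-updI f x a xs as (head∉tail u))) (Sat-∀ᵢ*⁻ (updI f x a) xs F u′ (s a) as)

  Sat-∀ᵢ*⁺ : ∀ {n} (f : Assignment 𝔖) (xs : Vec IVar n) F → Unique xs →
             (∀ as → Sat 𝔖 (updV f xs as) F) → Sat 𝔖 f (∀ᵢ* xs F)
  Sat-∀ᵢ*⁺ f []       F _ s = s []
  Sat-∀ᵢ*⁺ f (x ∷ xs) F u@(_ ∷ u′) s a = Sat-∀ᵢ*⁺ (updI f x a) xs F u′ λ as →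
    Sat-resp-Agree F (≈⇒Agree (Agree-sym (updV-updI f x a xs as (head∉tail u)))) (s (a ∷ as))

  updV-updP-self : ∀ {n} (f : Assignment 𝔖) k .(nz : NonZero k) Q α (xs : Vec IVar n) as →
                   pred (updV (updP f k nz Q α) xs as) k nz Q ≡ α
  updV-updP-self f k nz Q α xs as = trans (updV-pred _ xs as k nz Q) (updP-self f k nz Q α)

  Sat-atom-⇔ : ∀ (f : Assignment 𝔖) {k l} .(nzk : NonZero k) .(nzl : NonZero l) P Q xs ys →
               proj₁ (pred f k nzk P) (map (ind f) xs) ≡ proj₁ (pred f l nzl Q) (map (ind f) ys) →
               Sat 𝔖 f (atom k nzk P xs ⇔ᶠ atom l nzl Q ys)
  Sat-atom-⇔ f nzk nzl P Q xs ys P[xs]≡Q[ys] =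
    (λ P[xs] → trans (sym P[xs]≡Q[ys]) P[xs]) , (λ Q[ys] → trans P[xs]≡Q[ys] Q[ys])

  𝒜-updP-fresh : ∀ (f : Assignment 𝔖) {n} m .(nzm : NonZero m) (xs : Vec IVar n) D H k .(nzk : NonZero k) S σ →
                 ¬ OccP k S H → ∀ ξ δ → 𝒜 𝔖 f m nzm xs D H ξ δ → 𝒜 𝔖 (updP f k nzk S σ) m nzm xs D H ξ δ
  𝒜-updP-fresh f m nzm xs D H k nzk S σ S∉H ξ δ =
    Sat-resp-Agree H (updP-cong m nzm D δ (updV-cong xs ξ f≈f[S/σ]))
    where
    f≈f[S/σ] : Agree (λ l Q → OccP l Q H) f (updP f k nzk S σ)
    f≈f[S/σ] = (λ _ → refl) , λ l nzl Q Q∈H → sym (updP-other f k nzk S σ l nzl Q λ { (refl , refl) → S∉H Q∈H })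

  Sat-∀∃-graph : ∀ (f : Assignment 𝔖) {n m} (nzn : NonZero n) .(nzm : NonZero m)
                 (x : Vec IVar n) (y : Vec IVar m) D H S σ (σ∈J : J 𝔖 (n + m) (nz+ n m nzn) σ) →
                 Unique x → Unique y → (∀ v → v ∈ y → v ∉ x) → ¬ OccP (n + m) S H →
                 (δ : Vec (I 𝔖) n → Elt 𝔖 m nzm) → (∀ ξ → 𝒜 𝔖 f m nzm x D H ξ (δ ξ)) →
                 (∀ ξ η → σ (ξ ++ η) ≡ proj₁ (δ ξ) η) →
                 Sat 𝔖 (updP f (n + m) (nz+ n m nzn) S (σ , σ∈J))
                   (∀ᵢ* x (∃ₚ m nzm D (∀ᵢ* y (atom m nzm D y ⇔ᶠ atom (n + m) (nz+ n m nzn) S (x ++ y)) ∧ᶠ H)))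
  Sat-∀∃-graph f {n} {m} nzn nzm x y D H S σ σ∈J ux uy y#x S∉H δ δ∈𝒜 σ-graph =
    Sat-∀ᵢ*⁺ f[S] x _ ux λ ξ →
      δ ξ , Sat-∀ᵢ*⁺ (g ξ) y _ uy (D⇔S ξ) , 𝒜-updP-fresh f m nzm x D H (n + m) nzS S σ̂ S∉H ξ (δ ξ) (δ∈𝒜 ξ)
    where
    nzS : NonZero (n + m)
    nzS = nz+ n m nzn

    σ̂ : Elt 𝔖 (n + m) nzS
    σ̂ = σ , σ∈J

    f[S] : Assignment 𝔖
    f[S] = updP f (n + m) nzS S σ̂

    g : Vec (I 𝔖) n → Assignment 𝔖
    g ξ = updP (updV f[S] x ξ) m nzm D (δ ξ)

    S-at : ∀ ξ η → pred (updV (g ξ) y η) (n + m) nzS S ≡ σ̂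
    S-at ξ η = begin
      pred (updV (g ξ) y η) (n + m) nzS S ≡⟨ updV-pred (g ξ) y η (n + m) nzS S ⟩
      pred (g ξ) (n + m) nzS S            ≡⟨ updP-other _ m nzm D (δ ξ) (n + m) nzS S (n+m≢m n m nzn ∘ proj₁) ⟩
      pred (updV f[S] x ξ) (n + m) nzS S  ≡⟨ updV-updP-self f (n + m) nzS S σ̂ x ξ ⟩
      σ̂                                   ∎
      where open ≡-Reasoning

    D⇔S : ∀ ξ η → Sat 𝔖 (updV (g ξ) y η) (atom m nzm D y ⇔ᶠ atom (n + m) nzS S (x ++ y))
    D⇔S ξ η = Sat-atom-⇔ h nzm nzS D S y (x ++ y) (begin
      proj₁ (pred h m nzm D) (map (ind h) y)
        ≡⟨ cong₂ proj₁ (updV-updP-self _ m nzm D (δ ξ) y η) (updV-self (g ξ) y η uy) ⟩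
      proj₁ (δ ξ) η
        ≡⟨ sym (σ-graph ξ η) ⟩
      σ (ξ ++ η)
        ≡⟨ sym (cong₂ proj₁ (S-at ξ η) (updV-self-++ (g ξ) x y ξ η uy y#x (updV-self f[S] x ξ ux))) ⟩
      proj₁ (pred h (n + m) nzS S) (map (ind h) (x ++ y))
        ∎)
      where
      open ≡-Reasoning
      h : Assignment 𝔖
      h = updV (g ξ) y η

lemma4p3 : (𝔖 : Structure) (f : Assignment 𝔖) (n m : ℕ) (nzn : NonZero n) (nzm : NonZero m)
    (x : Vec IVar n) → Unique x → (D : PName) (H : Formula) →
    (Sat 𝔖 f (∀ᵢ* x (∃ₚ m nzm D H)) →
      (ξ : Vec (I 𝔖) n) → Σ (Elt 𝔖 m nzm) (𝒜 𝔖 f m nzm x D H ξ))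
    ×
    ((y : Vec IVar m) → Unique y →
      (∀ v → Any (v ≡_) y → ¬ OccI v H) →
      (∀ v → Any (v ≡_) y → ¬ Any (v ≡_) x) →
      (S : PName) → ¬ OccP (n + m) S H →
      (φ : (Elt 𝔖 m nzm → Set) → Elt 𝔖 m nzm) →
      ((ξ : Vec (I 𝔖) n) → 𝒜 𝔖 f m nzm x D H ξ (φ (𝒜 𝔖 f m nzm x D H ξ))) →
      (σ : Pred (I 𝔖) (n + m)) (σ∈J : J 𝔖 (n + m) (nz+ n m nzn) σ) →
      ((ξ : Vec (I 𝔖) n) (η : Vec (I 𝔖) m) →
        σ (ξ ++ η) ≡ proj₁ (φ (𝒜 𝔖 f m nzm x D H ξ)) η) →
      Sat 𝔖 (updP f (n + m) (nz+ n m nzn) S (σ , σ∈J))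
        (∀ᵢ* x (∃ₚ m nzm D
          (∀ᵢ* y (atom m nzm D y ⇔ᶠ atom (n + m) (nz+ n m nzn) S (x ++ y)) ∧ᶠ H))))
lemma4p3 𝔖 f n m nzn nzm x ux D H =
  Sat-∀ᵢ*⁻ f x (∃ₚ m nzm D H) ux ,
  λ y uy _ y#x S S∉H φ φ-choice σ σ∈J σ-graph →
    Sat-∀∃-graph f nzn nzm x y D H S σ σ∈J ux uy y#x S∉H (λ ξ → φ (𝒜 𝔖 f m nzm x D H ξ)) φ-choice σ-graph
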